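{- There exists a finite simple undirected graph with maximum degree $306$, diameter $2$, and $88723$ vertices (namely $\mathrm{B}(\mathbb Z_{17^2})$), and there exists a finite simple undirected graph with maximum degree $307$, diameter $2$, and $88724$ vertices (obtained from $\mathrm{B}(\mathbb Z_{17^2})$ by adding one new vertex adjacent exactly to the neighbours of a chosen existing vertex).
   Context: For a commutative ring $R$ with unity, let $R^*$ be its group of units, and for $\mathbf v,\mathbf w\in R^3$ let $\mathbf v\cdot\mathbf w = v_1w_1+v_2w_2+v_3w_3$. The graph $\mathrm{B}(R)$ is the simple undirected graph whose vertex set is $\bigl(R^3 \setminus \{\mathbf v \in R^3 : r\mathbf v = \mathbf 0 \text{ for some } r \in R,\ r\neq 0\}\bigr)/\sim$, where $\mathbf v \sim \mathbf w$ iff $k\mathbf v = \mathbf w$ for some $k \in R^*$; two distinct vertices $[\mathbf v]$, $[\mathbf w]$ are adjacent iff $\mathbf v\cdot\mathbf w = 0$. Here $\mathbb Z_{17^2}=\mathbb Z/289\mathbb Z$. The maximum degree of a graph is the largest number of neighbours of a vertex; the diameter is the maximum over all pairs of vertices of the length of a shortest path between them. -}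

module Defs where

open import Data.Nat using (ℕ; zero; suc; _≤_; _∸_)
open import Data.Fin using (Fin)
open import Data.Bool using (Bool; T)
open import Data.List using (List; filter; length)
open import Data.List using (allFin)
open import Data.Product using (Σ; ∃; _×_; ∃-syntax)
open import Relation.Nullary using (¬_)
open import Relation.Binary.PropositionalEquality using (_≡_)
open import Data.Bool using (T?)

-- Simple = no loops, no multi-edges
-- (an adjacency relation cannot have multi-edges).
record SimpleGraph (n : ℕ) : Set where
  field
    adj       : Fin n → Fin n → Bool
    irrefl    : ∀ i → ¬ T (adj i i)
    symmetric : ∀ i j → adj i j ≡ adj j i

open SimpleGraph public

degree : ∀ {n} → SimpleGraph n → Fin n → ℕ
degree {n} G i = length (filter (λ j → T? (adj G i j)) (allFin n))

MaxDegree : ∀ {n} → SimpleGraph n → ℕ → Set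
MaxDegree {n} G Δ = (∀ i → degree G i ≤ Δ) × (∃[ i ] degree G i ≡ Δ)

data Walk {n : ℕ} (G : SimpleGraph n) : ℕ → Fin n → Fin n → Set where
  nil  : ∀ {i} → Walk G 0 i i
  cons : ∀ {k i j l} → T (adj G i j) → Walk G k j l → Walk G (suc k) i l

-- dist(i, j) ≤ d : there is a path (equivalently a walk) of length at most d.
DistLE : ∀ {n} → SimpleGraph n → Fin n → Fin n → ℕ → Set
DistLE G i j d = ∃[ k ] (k ≤ d × Walk G k i j)

Diameter : ∀ {n} → SimpleGraph n → ℕ → Set
Diameter {n} G D =
  (∀ i j → DistLE G i j D) × (∃[ i ] ∃[ j ] ¬ DistLE G i j (D ∸ 1))

-- The vertices of B(ℤ/p²) are the points of the projective plane over ℤ/p²: every vector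
-- with a unit coordinate is, up to a unit, exactly one of (1, a, b), (pc, 1, b), (pc, pd, 1)
-- with a, b < p² and c, d < p, so there are p⁴ + p³ + p² of them.  Permuting coordinates, a
-- vertex is (1, a, b); its neighbours w satisfy w₁ ≡ -(a w₂ + b w₃), so they are determined by
-- (w₂ : w₃), a point of the projective line over ℤ/p², which has p² + p points.  This bounds
-- all degrees by p² + p, and (1, 0, 0) attains it.  For the diameter, a second vertex w is
-- either a unit multiple of (1, a, b), or (w₂ - w₁a, w₃ - w₁b) = k (f₂, f₃) with (f₂, f₃) not
-- divisible by p, and then (b f₂ - a f₃, f₃, -f₂) is a common neighbour.  Adding a twin of a
-- neighbour of (1, 0, 0) raises the maximum degree by one and keeps the diameter 2.
module Submission where

open import Defs
open import Data.Bool using (Bool; true; false; T; T?; not; _∧_; if_then_else_)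
open import Data.Bool.Properties using (T-≡)
open import Data.Empty using (⊥-elim)
open import Data.Empty.Irrelevant renaming (⊥-elim to ⊥-elim-irrelevant)
open import Data.Fin using (Fin; zero; suc; toℕ; fromℕ<; join; splitAt; _≟_)
open import Data.Fin.Properties
  using (toℕ-fromℕ<; toℕ<n; toℕ-injective; injective⇒≤; +↔⊎; *↔×)
open import Data.Integer
  using (ℤ; +_; -_; _+_; _-_; _*_; 0ℤ; 1ℤ; _%ℕ_; _/ℕ_; ∣_∣)
open import Data.Integer.Properties
  using ( +-comm; *-comm; *-assoc; +-identityˡ; +-identityʳ; *-identityˡ; *-identityʳ
        ; *-zeroʳ; +-inverseʳ; *-distribʳ-+; neg-distribˡ-*; neg-involutive; pos-+; pos-*; abs-*
        ; m-n≡m⊖n; ∣m⊖n∣≡∣n⊖m∣; ∣⊖∣-≤ )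
open import Data.Integer.DivMod using (a≡a%ℕn+[a/ℕn]*n; n%ℕd<d)
open import Data.Integer.Divisibility.Signed
  using (_∣_; divides; _∣?_; ∣ᵤ⇒∣; ∣⇒∣ᵤ; ∣m⇒∣-m; ∣m⇒∣m*n; ∣n⇒∣m*n; ∣m∣n⇒∣m+n
        ; ∣m∣n⇒∣m-n)
open import Data.Integer.Tactic.RingSolver as ℤ-Solver using ()
open import Data.List using (List; []; _∷_; filter; length; allFin; lookup; tabulate; map)
open import Data.List.Properties using (map-tabulate)
open import Data.List.Membership.Propositional using (_∈_)
open import Data.List.Membership.Propositional.Properties
  using (∈-filter⁺; ∈-filter⁻; ∈-allFin; ∈-lookup)
import Data.List.Relation.Unary.All as All
import Data.List.Relation.Unary.AllPairs as AllPairs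
import Data.List.Relation.Unary.Any as Any
open import Data.List.Relation.Unary.Any.Properties using (lookup-index)
open import Data.List.Relation.Unary.Unique.Propositional using (Unique)
open import Data.List.Relation.Unary.Unique.Propositional.Properties using (allFin⁺; filter⁺)
open import Data.Nat as ℕ using (ℕ; zero; suc; z≤n; s≤s)
import Data.Nat.Properties as ℕ
import Data.Nat.Divisibility as ℕ
open import Data.Nat.Coprimality
  using (Coprime; coprime-Bézout; gcd≡1⇒coprime; coprime-divisor; recompute)
open import Data.Nat.DivMod using (m<n*o⇒m/o<n; m*[n/m]≡n)
open import Data.Nat.GCD using (module Bézout; gcd[m,n]∣m; gcd[m,n]∣n)
open import Data.Nat.Primality
  using (Prime; prime?; euclidsLemma; prime⇒nonZero; prime⇒nonTrivial; prime⇒irreducible)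
open import Data.Product using (Σ; _×_; _,_; proj₁; proj₂; Σ-syntax) renaming (swap to ×-swap)
open import Data.Sum using (_⊎_; inj₁; inj₂)
open import Data.Sum.Function.Propositional using (_⊎-↔_)
open import Data.Sum.Properties using (inj₁-injective; inj₂-injective)
open import Function using (_∘_; Injective)
open import Function.Bundles using (_↔_; Inverse; Injection; Equivalence)
open import Function.Properties.Inverse using (↔-trans; ↔-sym; ↔⇒↣)
open import Level using (0ℓ)
open import Relation.Binary.Bundles using (Setoid)
open import Relation.Binary.Definitions using (Decidable)
open import Relation.Binary.PropositionalEquality
  using (_≡_; _≢_; refl; sym; trans; cong; cong₂; subst; subst₂; module ≡-Reasoning)
import Relation.Binary.Reasoning.Setoid as SetoidReasoning
open import Relation.Nullary using (¬_; Dec; yes; no; map′; _×-dec_)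
open import Relation.Nullary.Decidable using (⌊_⌋; toWitness; fromWitness; from-yes)

V : Set
V = ℤ × ℤ × ℤ

infix 7 _∙_
infixr 8 _·_

_∙_ : V → V → ℤ
(x₁ , x₂ , x₃) ∙ (y₁ , y₂ , y₃) = x₁ * y₁ + x₂ * y₂ + x₃ * y₃

_·_ : ℤ → V → V
k · (x₁ , x₂ , x₃) = k * x₁ , k * x₂ , k * x₃

∙-comm : ∀ v w → v ∙ w ≡ w ∙ v
∙-comm (x₁ , x₂ , x₃) (y₁ , y₂ , y₃) =
  cong₂ _+_ (cong₂ _+_ (*-comm x₁ y₁) (*-comm x₂ y₂)) (*-comm x₃ y₃)

∙-· : ∀ v k w → v ∙ (k · w) ≡ k * (v ∙ w)
∙-· (x₁ , x₂ , x₃) k (y₁ , y₂ , y₃) = factor-out x₁ x₂ x₃ k y₁ y₂ y₃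
  where
  factor-out : ∀ x₁ x₂ x₃ k y₁ y₂ y₃ →
               x₁ * (k * y₁) + x₂ * (k * y₂) + x₃ * (k * y₃) ≡ k * (x₁ * y₁ + x₂ * y₂ + x₃ * y₃)
  factor-out = ℤ-Solver.solve-∀

data Swap : Set where
  keep swap₁₂ swap₁₃ : Swap

swap : Swap → V → V
swap keep   v              = v
swap swap₁₂ (x₁ , x₂ , x₃) = x₂ , x₁ , x₃
swap swap₁₃ (x₁ , x₂ , x₃) = x₃ , x₂ , x₁

swap-involutive : ∀ s v → swap s (swap s v) ≡ v
swap-involutive keep   v           = refl
swap-involutive swap₁₂ (_ , _ , _) = refl
swap-involutive swap₁₃ (_ , _ , _) = refl

swap-∙ : ∀ s v w → swap s v ∙ swap s w ≡ v ∙ w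
swap-∙ keep   v              w              = refl
swap-∙ swap₁₂ (x₁ , x₂ , x₃) (y₁ , y₂ , y₃) = cong (_+ x₃ * y₃) (+-comm (x₂ * y₂) (x₁ * y₁))
swap-∙ swap₁₃ (x₁ , x₂ , x₃) (y₁ , y₂ , y₃) = reverse-sum (x₁ * y₁) (x₂ * y₂) (x₃ * y₃)
  where
  reverse-sum : ∀ a b c → c + b + a ≡ a + b + c
  reverse-sum = ℤ-Solver.solve-∀

swap-· : ∀ s k v → swap s (k · v) ≡ k · swap s v
swap-· keep   k v           = refl
swap-· swap₁₂ k (_ , _ , _) = refl
swap-· swap₁₃ k (_ , _ , _) = refl

-- Working over ℤ rather than with residues keeps every ring identity exact, so that the
-- integer ring solver proves them for a variable modulus.
module Modulo (n : ℕ) where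

  infix 4 _≈_
  record _≈_ (a b : ℤ) : Set where
    constructor mk
    field divides-difference : + n ∣ a - b

  ≡⇒≈ : ∀ {a b} → a ≡ b → a ≈ b
  ≡⇒≈ {a} refl = mk (divides 0ℤ (+-inverseʳ a))

  ≈-refl : ∀ {a} → a ≈ a
  ≈-refl = ≡⇒≈ refl

  ≈-sym : ∀ {a b} → a ≈ b → b ≈ a
  ≈-sym {a} {b} (mk (divides q a-b≡qn)) = mk (divides (- q) (begin
    b - a         ≡⟨ ℤ-Solver.solve (a ∷ b ∷ []) ⟩
    - (a - b)     ≡⟨ cong -_ a-b≡qn ⟩
    - (q * + n)   ≡⟨ neg-distribˡ-* q (+ n) ⟩
    - q * + n     ∎))
    where open ≡-Reasoning

  ≈-trans : ∀ {a b c} → a ≈ b → b ≈ c → a ≈ c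
  ≈-trans {a} {b} {c} (mk (divides q a-b≡qn)) (mk (divides r b-c≡rn)) =
    mk (divides (q + r) (begin
      a - c               ≡⟨ ℤ-Solver.solve (a ∷ b ∷ c ∷ []) ⟩
      (a - b) + (b - c)   ≡⟨ cong₂ _+_ a-b≡qn b-c≡rn ⟩
      q * + n + r * + n   ≡⟨ *-distribʳ-+ (+ n) q r ⟨
      (q + r) * + n       ∎))
    where open ≡-Reasoning

  setoid : Setoid 0ℓ 0ℓ
  setoid = record
    { _≈_           = _≈_
    ; isEquivalence = record { refl = ≈-refl ; sym = ≈-sym ; trans = ≈-trans }
    }

  +-cong : ∀ {a b c d} → a ≈ b → c ≈ d → a + c ≈ b + d
  +-cong {a} {b} {c} {d} (mk (divides q a-b≡qn)) (mk (divides r c-d≡rn)) =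
    mk (divides (q + r) (begin
      (a + c) - (b + d)   ≡⟨ ℤ-Solver.solve (a ∷ b ∷ c ∷ d ∷ []) ⟩
      (a - b) + (c - d)   ≡⟨ cong₂ _+_ a-b≡qn c-d≡rn ⟩
      q * + n + r * + n   ≡⟨ *-distribʳ-+ (+ n) q r ⟨
      (q + r) * + n       ∎))
    where open ≡-Reasoning

  *-cong : ∀ {a b c d} → a ≈ b → c ≈ d → a * c ≈ b * d
  *-cong {a} {b} {c} {d} (mk (divides q a-b≡qn)) (mk (divides r c-d≡rn)) =
    mk (divides (a * r + q * d) (begin
      a * c - b * d               ≡⟨ ℤ-Solver.solve (a ∷ b ∷ c ∷ d ∷ []) ⟩
      a * (c - d) + (a - b) * d   ≡⟨ cong₂ (λ x y → a * x + y * d) c-d≡rn a-b≡qn ⟩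
      a * (r * + n) + q * + n * d ≡⟨ factor-out a r q d (+ n) ⟩
      (a * r + q * d) * + n       ∎))
    where
    open ≡-Reasoning
    factor-out : ∀ a r q d N → a * (r * N) + q * N * d ≡ (a * r + q * d) * N
    factor-out = ℤ-Solver.solve-∀

  -‿cong : ∀ {a b} → a ≈ b → - a ≈ - b
  -‿cong {a} {b} (mk (divides q a-b≡qn)) = mk (divides (- q) (begin
    - a - - b     ≡⟨ ℤ-Solver.solve (a ∷ b ∷ []) ⟩
    - (a - b)     ≡⟨ cong -_ a-b≡qn ⟩
    - (q * + n)   ≡⟨ neg-distribˡ-* q (+ n) ⟩
    - q * + n     ∎))
    where open ≡-Reasoning

  infix 4 _≈?_
  _≈?_ : Decidable _≈_
  a ≈? b = map′ mk _≈_.divides-difference (+ n ∣? a - b)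

  multiple≈0 : ∀ q → q * + n ≈ 0ℤ
  multiple≈0 q = mk (divides q (+-identityʳ (q * + n)))

  difference≈0 : ∀ {x y} → x - y ≈ 0ℤ → x ≈ y
  difference≈0 {x} {y} x-y≈0 =
    ≈-trans (≡⇒≈ (regroup x y)) (≈-trans (+-cong x-y≈0 (≈-refl {y})) (≡⇒≈ (+-identityˡ y)))
    where
    regroup : ∀ x y → x ≡ (x - y) + y
    regroup = ℤ-Solver.solve-∀

  ∣-resp-≈ : ∀ {d a b} → d ℕ.∣ n → a ≈ b → + d ∣ a → + d ∣ b
  ∣-resp-≈ {d} {a} {b} d∣n (mk (divides q a-b≡qn)) d∣a =
    subst (+ d ∣_) a-qn≡b (∣m∣n⇒∣m-n d∣a (∣n⇒∣m*n q (∣ᵤ⇒∣ d∣n)))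
    where
    open ≡-Reasoning
    a-qn≡b : a - q * + n ≡ b
    a-qn≡b = begin
      a - q * + n     ≡⟨ cong (λ x → a - x) a-b≡qn ⟨
      a - (a - b)     ≡⟨ ℤ-Solver.solve (a ∷ b ∷ []) ⟩
      b               ∎

  coprime⇒invertible : ∀ {r} → Coprime r n → Σ[ y ∈ ℤ ] + r * y ≈ 1ℤ
  coprime⇒invertible {r} r⊥n with coprime-Bézout r⊥n
  ... | Bézout.+- x y 1+yn≡xr = + x , mk (divides (+ y) (begin
    + r * + x - 1ℤ           ≡⟨ cong (_- 1ℤ) (trans (*-comm (+ r) (+ x)) (sym (pos-* x r))) ⟩
    + (x ℕ.* r) - 1ℤ         ≡⟨ cong (λ m → + m - 1ℤ) 1+yn≡xr ⟨
    + (1 ℕ.+ y ℕ.* n) - 1ℤ   ≡⟨ cong (_- 1ℤ) (trans (pos-+ 1 (y ℕ.* n))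
                                                    (cong (λ m → 1ℤ + m) (pos-* y n))) ⟩
    1ℤ + + y * + n - 1ℤ      ≡⟨ cancel (+ y * + n) ⟩
    + y * + n                ∎))
    where
    open ≡-Reasoning
    cancel : ∀ a → 1ℤ + a - 1ℤ ≡ a
    cancel = ℤ-Solver.solve-∀
  ... | Bézout.-+ x y 1+xr≡yn = - + x , mk (divides (- + y) (begin
    + r * - + x - 1ℤ           ≡⟨ regroup (+ r) (+ x) ⟩
    - (1ℤ + + x * + r)         ≡⟨ cong (λ m → - (1ℤ + m)) (pos-* x r) ⟨
    - (1ℤ + + (x ℕ.* r))       ≡⟨ cong -_ (pos-+ 1 (x ℕ.* r)) ⟨
    - + (1 ℕ.+ x ℕ.* r)        ≡⟨ cong (λ m → - + m) 1+xr≡yn ⟩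
    - + (y ℕ.* n)              ≡⟨ cong -_ (pos-* y n) ⟩
    - (+ y * + n)              ≡⟨ neg-distribˡ-* (+ y) (+ n) ⟩
    - + y * + n                ∎))
    where
    open ≡-Reasoning
    regroup : ∀ r x → r * - x - 1ℤ ≡ - (1ℤ + x * r)
    regroup = ℤ-Solver.solve-∀

  module _ .{{_ : ℕ.NonZero n}} where

    %ℕ-≈ : ∀ i → + (i %ℕ n) ≈ i
    %ℕ-≈ i = mk (divides (- (i /ℕ n)) (begin
      + (i %ℕ n) - i                              ≡⟨ cong (λ x → + (i %ℕ n) - x) (a≡a%ℕn+[a/ℕn]*n i n) ⟩
      + (i %ℕ n) - (+ (i %ℕ n) + (i /ℕ n) * + n)  ≡⟨ cancel (+ (i %ℕ n)) (i /ℕ n) (+ n) ⟩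
      - (i /ℕ n) * + n                            ∎))
      where
      open ≡-Reasoning
      cancel : ∀ r q N → r - (r + q * N) ≡ - q * N
      cancel = ℤ-Solver.solve-∀

    private
      ∣∧<⇒≡0 : ∀ {m} → n ℕ.∣ m → m ℕ.< n → m ≡ 0
      ∣∧<⇒≡0 {zero}  _   _   = refl
      ∣∧<⇒≡0 {suc m} n∣m m<n = ⊥-elim (ℕ.<⇒≱ m<n (ℕ.∣⇒≤ n∣m))

      ≈-≥⇒≡ : ∀ {a b} → b ℕ.≤ a → a ℕ.< n → + a ≈ + b → a ≡ b
      ≈-≥⇒≡ {a} {b} b≤a a<n (mk n∣a-b) = ℕ.≤-antisym (ℕ.m∸n≡0⇒m≤n a∸b≡0) b≤a
        where
        ∣a-b∣≡a∸b : ∣ + a - + b ∣ ≡ a ℕ.∸ b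
        ∣a-b∣≡a∸b = trans (cong ∣_∣ (m-n≡m⊖n a b)) (trans (∣m⊖n∣≡∣n⊖m∣ a b) (∣⊖∣-≤ b≤a))
        a∸b≡0 : a ℕ.∸ b ≡ 0
        a∸b≡0 = ∣∧<⇒≡0 (subst (n ℕ.∣_) ∣a-b∣≡a∸b (∣⇒∣ᵤ n∣a-b))
                       (ℕ.≤-<-trans (ℕ.m∸n≤m a b) a<n)

    +-≈-injective : ∀ {a b} → a ℕ.< n → b ℕ.< n → + a ≈ + b → a ≡ b
    +-≈-injective {a} {b} a<n b<n a≈b with ℕ.≤-total b a
    ... | inj₁ b≤a = ≈-≥⇒≡ b≤a a<n a≈b
    ... | inj₂ a≤b = sym (≈-≥⇒≡ a≤b b<n (≈-sym a≈b))

    1≉0 : 1 ℕ.< n → ¬ 1ℤ ≈ 0ℤ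
    1≉0 1<n 1≈0 = ℕ.1+n≢0 (+-≈-injective 1<n (ℕ.<-trans ℕ.z<s 1<n) 1≈0)

  infix 4 _≈ᵛ_ _⊥_

  _≈ᵛ_ : V → V → Set
  (x₁ , x₂ , x₃) ≈ᵛ (y₁ , y₂ , y₃) = x₁ ≈ y₁ × x₂ ≈ y₂ × x₃ ≈ y₃

  _⊥_ : V → V → Set
  v ⊥ w = v ∙ w ≈ 0ℤ

  ∙-congˡ : ∀ v {w w′} → w ≈ᵛ w′ → v ∙ w ≈ v ∙ w′
  ∙-congˡ (x₁ , x₂ , x₃) {_ , _ , _} {_ , _ , _} (w₁≈ , w₂≈ , w₃≈) =
    +-cong (+-cong (*-cong (≈-refl {x₁}) w₁≈) (*-cong (≈-refl {x₂}) w₂≈))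
           (*-cong (≈-refl {x₃}) w₃≈)

  swap-≈ᵛ : ∀ s {v w} → v ≈ᵛ w → swap s v ≈ᵛ swap s w
  swap-≈ᵛ keep   v≈w = v≈w
  swap-≈ᵛ swap₁₂ {_ , _ , _} {_ , _ , _} (≈₁ , ≈₂ , ≈₃) = ≈₂ , ≈₁ , ≈₃
  swap-≈ᵛ swap₁₃ {_ , _ , _} {_ , _ , _} (≈₁ , ≈₂ , ≈₃) = ≈₃ , ≈₂ , ≈₁

  unswap-≈ᵛ : ∀ s {v w} k → swap s v ≈ᵛ k · swap s w → v ≈ᵛ k · w
  unswap-≈ᵛ s {v} {w} k sv≈ksw =
    subst₂ _≈ᵛ_ (swap-involutive s v) (trans (swap-· s k (swap s w)) (cong (k ·_) (swap-involutive s w)))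
           (swap-≈ᵛ s sv≈ksw)

  swap-⊥ : ∀ s {v w} → swap s v ⊥ w → v ⊥ swap s w
  swap-⊥ s {v} {w} =
    subst (_≈ 0ℤ) (trans (cong (swap s v ∙_) (sym (swap-involutive s w))) (swap-∙ s v (swap s w)))

  ⊥-scaled : ∀ v {w w′} k → w′ ≈ᵛ k · w → v ⊥ w → v ⊥ w′
  ⊥-scaled v {w} k w′≈kw v⊥w =
    ≈-trans (∙-congˡ v w′≈kw)
      (≈-trans (≡⇒≈ (∙-· v k w)) (≈-trans (*-cong (≈-refl {k}) v⊥w) (≡⇒≈ (*-zeroʳ k))))

lookup-injective : ∀ {A : Set} {xs : List A} → Unique xs → Injective _≡_ _≡_ (lookup xs)
lookup-injective {xs = _ ∷ _} _                     {zero}  {zero}  _ = refl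
lookup-injective {xs = _ ∷ _} (x∉xs AllPairs.∷ _)   {zero}  {suc j} x≡xsⱼ =
  ⊥-elim (All.lookup x∉xs (∈-lookup j) x≡xsⱼ)
lookup-injective {xs = _ ∷ _} (x∉xs AllPairs.∷ _)   {suc i} {zero}  xsᵢ≡x =
  ⊥-elim (All.lookup x∉xs (∈-lookup i) (sym xsᵢ≡x))
lookup-injective {xs = _ ∷ _} (_ AllPairs.∷ unique) {suc i} {suc j} xsᵢ≡xsⱼ =
  cong suc (lookup-injective unique xsᵢ≡xsⱼ)

count : ∀ {n} → (Fin n → Bool) → ℕ
count {n} P = length (filter (λ j → T? (P j)) (allFin n))

length-filter-map : ∀ {A B : Set} (P : B → Bool) (f : A → B) xs →
  length (filter (λ y → T? (P y)) (map f xs)) ≡ length (filter (λ x → T? (P (f x))) xs)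
length-filter-map P f []       = refl
length-filter-map P f (x ∷ xs) with P (f x)
... | true  = cong suc (length-filter-map P f xs)
... | false = length-filter-map P f xs

count-tabulate-suc : ∀ {n} (P : Fin (suc n) → Bool) →
  length (filter (λ j → T? (P j)) (tabulate suc)) ≡ count (P ∘ suc)
count-tabulate-suc {n} P =
  trans (cong (length ∘ filter (λ j → T? (P j))) (sym (map-tabulate (λ j → j) suc)))
        (length-filter-map P suc (allFin n))

count-suc : ∀ {n} (P : Fin (suc n) → Bool) → count P ≡ (if P zero then 1 else 0) ℕ.+ count (P ∘ suc)
count-suc P with P zero
... | true  = cong suc (count-tabulate-suc P)
... | false = count-tabulate-suc P

module _ {N : ℕ} (G : SimpleGraph N) where

  private
    neighbours : Fin N → List (Fin N)
    neighbours i = filter (λ j → T? (adj G i j)) (allFin N)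

  degree-≤ : ∀ {m} i (f : ∀ j → T (adj G i j) → Fin m) →
             (∀ {j k} ij ik → f j ij ≡ f k ik → j ≡ k) → degree G i ℕ.≤ m
  degree-≤ i f f-injective =
    injective⇒≤ {f = λ t → f (lookup (neighbours i) t) (adjacent t)}
                (lookup-injective unique ∘ f-injective (adjacent _) (adjacent _))
    where
    unique : Unique (neighbours i)
    unique = filter⁺ (λ j → T? (adj G i j)) (allFin⁺ N)
    adjacent : ∀ t → T (adj G i (lookup (neighbours i) t))
    adjacent t = proj₂ (∈-filter⁻ (λ j → T? (adj G i j)) {xs = allFin N} (∈-lookup t))

  ≤-degree : ∀ {m} i (g : Fin m → Fin N) → Injective _≡_ _≡_ g → (∀ k → T (adj G i (g k))) →
             m ℕ.≤ degree G i
  ≤-degree i g g-injective g-adjacent = injective⇒≤ {f = Any.index ∘ member} λ {k} {l} same →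
    g-injective (trans (lookup-index (member k))
                       (trans (cong (lookup (neighbours i)) same) (sym (lookup-index (member l)))))
    where
    member : ∀ k → g k ∈ neighbours i
    member k = ∈-filter⁺ (λ j → T? (adj G i j)) (∈-allFin (g k)) (g-adjacent k)

  adj-sym : ∀ {i j} → T (adj G i j) → T (adj G j i)
  adj-sym {i} {j} = subst T (symmetric G i j)

  walk-snoc : ∀ {k i j l} → Walk G k i j → T (adj G j l) → Walk G (suc k) i l
  walk-snoc nil        jl = cons jl nil
  walk-snoc (cons e w) jl = cons e (walk-snoc w jl)

  walk-reverse : ∀ {k i j} → Walk G k i j → Walk G k j i
  walk-reverse nil        = nil
  walk-reverse (cons e w) = walk-snoc (walk-reverse w) (adj-sym e)

  DistLE-sym : ∀ {i j d} → DistLE G i j d → DistLE G j i d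
  DistLE-sym (k , k≤d , w) = k , k≤d , walk-reverse w

  ¬adj⇒¬DistLE1 : ∀ {i j} → i ≢ j → ¬ T (adj G i j) → ¬ DistLE G i j 1
  ¬adj⇒¬DistLE1 i≢j _   (zero , _ , nil)             = i≢j refl
  ¬adj⇒¬DistLE1 _   ¬ij (suc zero , _ , cons ij nil) = ¬ij ij
  ¬adj⇒¬DistLE1 _   _   (suc (suc _) , s≤s () , _)

module _ {N : ℕ} (R : Fin N → Fin N → Bool) (R-sym : ∀ i j → R i j ≡ R j i) where

  loopless : SimpleGraph N
  loopless = record
    { adj       = λ i j → not ⌊ i ≟ j ⌋ ∧ R i j
    ; irrefl    = irrefl′
    ; symmetric = symmetric′
    }
    where
    irrefl′ : ∀ i → ¬ T (not ⌊ i ≟ i ⌋ ∧ R i i)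
    irrefl′ i with i ≟ i
    ... | yes _  = λ ()
    ... | no i≢i = ⊥-elim (i≢i refl)
    symmetric′ : ∀ i j → not ⌊ i ≟ j ⌋ ∧ R i j ≡ not ⌊ j ≟ i ⌋ ∧ R j i
    symmetric′ i j with i ≟ j | j ≟ i
    ... | yes _   | yes _   = refl
    ... | no _    | no _    = R-sym i j
    ... | yes i≡j | no j≢i  = ⊥-elim (j≢i (sym i≡j))
    ... | no i≢j  | yes j≡i = ⊥-elim (i≢j (sym j≡i))

  loopless-adj : ∀ {i j} → i ≢ j → T (R i j) → T (adj loopless i j)
  loopless-adj {i} {j} i≢j Rij with i ≟ j
  ... | yes i≡j = i≢j i≡j
  ... | no _    = Rij

  loopless-adj⁻ : ∀ {i j} → T (adj loopless i j) → T (R i j)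
  loopless-adj⁻ {i} {j} ij with i ≟ j
  ... | no _ = ij

  -- R may relate a vertex to itself; such a k still witnesses distance at most 2.
  loopless-DistLE2 : ∀ {i j k} → T (R i k) → T (R k j) → DistLE loopless i j 2
  loopless-DistLE2 {i} {j} {k} Rik Rkj with i ≟ k | k ≟ j
  ... | yes refl | yes refl = 0 , z≤n , nil
  ... | yes refl | no k≢j   = 1 , s≤s z≤n , cons (loopless-adj k≢j Rkj) nil
  ... | no i≢k   | yes refl = 1 , s≤s z≤n , cons (loopless-adj i≢k Rik) nil
  ... | no i≢k   | no k≢j   =
    2 , ℕ.≤-refl , cons (loopless-adj i≢k Rik) (cons (loopless-adj k≢j Rkj) nil)

module _ {N : ℕ} (G : SimpleGraph N) (u : Fin N) where

  twin : SimpleGraph (suc N)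
  twin = record { adj = twin-adj ; irrefl = twin-irrefl ; symmetric = twin-sym }
    where
    twin-adj : Fin (suc N) → Fin (suc N) → Bool
    twin-adj zero    zero    = false
    twin-adj zero    (suc j) = adj G u j
    twin-adj (suc i) zero    = adj G u i
    twin-adj (suc i) (suc j) = adj G i j
    twin-irrefl : ∀ i → ¬ T (twin-adj i i)
    twin-irrefl zero    ()
    twin-irrefl (suc i) = irrefl G i
    twin-sym : ∀ i j → twin-adj i j ≡ twin-adj j i
    twin-sym zero    zero    = refl
    twin-sym zero    (suc j) = refl
    twin-sym (suc i) zero    = refl
    twin-sym (suc i) (suc j) = symmetric G i j

  degree-twin-zero : degree twin zero ≡ degree G u
  degree-twin-zero = count-suc (adj twin zero)

  degree-twin-suc : ∀ i → degree twin (suc i) ≡ (if adj G u i then 1 else 0) ℕ.+ degree G i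
  degree-twin-suc i = count-suc (adj twin (suc i))

  twin-maxDegree : ∀ {Δ v} → MaxDegree G Δ → T (adj G u v) → degree G v ≡ Δ →
                   MaxDegree twin (suc Δ)
  twin-maxDegree {Δ} {v} (deg≤Δ , _) uv degv≡Δ = bound , suc v , degree-suc-v
    where
    indicator≤1 : ∀ b → (if b then 1 else 0) ℕ.≤ 1
    indicator≤1 true  = ℕ.≤-refl
    indicator≤1 false = z≤n
    bound : ∀ i → degree twin i ℕ.≤ suc Δ
    bound zero    = subst (ℕ._≤ suc Δ) (sym degree-twin-zero) (ℕ.m≤n⇒m≤1+n (deg≤Δ u))
    bound (suc i) = subst (ℕ._≤ suc Δ) (sym (degree-twin-suc i))
                          (ℕ.+-mono-≤ (indicator≤1 (adj G u i)) (deg≤Δ i))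
    degree-suc-v : degree twin (suc v) ≡ suc Δ
    degree-suc-v = trans (degree-twin-suc v)
                         (cong₂ (λ b d → (if b then 1 else 0) ℕ.+ d) (Equivalence.to T-≡ uv) degv≡Δ)

  twin-walk : ∀ {k i j} → Walk G k i j → Walk twin k (suc i) (suc j)
  twin-walk nil        = nil
  twin-walk (cons e w) = cons e (twin-walk w)

  twin-diameter : ∀ {v} → (∀ i j → DistLE G i j 2) → T (adj G u v) → Diameter twin 2
  twin-diameter {v} dist≤2 uv = within2 , zero , suc u , ¬adj⇒¬DistLE1 twin (λ ()) (irrefl G u)
    where
    from-new : ∀ j → DistLE twin zero (suc j) 2
    from-new j with dist≤2 u j
    ... | zero  , _   , nil      = 2 , ℕ.≤-refl , cons {j = suc v} uv (cons (adj-sym G uv) nil)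
    ... | suc k , k<2 , cons e w = suc k , k<2 , cons e (twin-walk w)
    within2 : ∀ i j → DistLE twin i j 2
    within2 zero    zero    = 0 , z≤n , nil
    within2 zero    (suc j) = from-new j
    within2 (suc i) zero    = DistLE-sym twin (from-new i)
    within2 (suc i) (suc j) with dist≤2 i j
    ... | k , k≤2 , w = k , k≤2 , twin-walk w

module BrownGraph (p : ℕ) (p-prime : Prime p) where

  n : ℕ
  n = p ℕ.* p

  instance
    p-nonZero : ℕ.NonZero p
    p-nonZero = prime⇒nonZero p-prime
    n-nonZero : ℕ.NonZero n
    n-nonZero = ℕ.m*n≢0 p p

  open Modulo n public

  1<p : 1 ℕ.< p
  1<p = ℕ.nonTrivial⇒n>1 p {{prime⇒nonTrivial p-prime}}

  1<n : 1 ℕ.< n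
  1<n = ℕ.<-≤-trans 1<p (ℕ.m≤m*n p p)

  0<p : 0 ℕ.< p
  0<p = ℕ.<-trans ℕ.z<s 1<p

  0<n : 0 ℕ.< n
  0<n = ℕ.<-trans ℕ.z<s 1<n

  infix 4 p∣_
  p∣_ : ℤ → Set
  p∣ x = + p ∣ x

  p∣? : ∀ x → Dec (p∣ x)
  p∣? x = + p ∣? x

  Unit : ℤ → Set
  Unit x = ¬ p∣ x

  UnimodularPair : ℤ → ℤ → Set
  UnimodularPair y z = ¬ (p∣ y × p∣ z)

  -- Over ℤ/p², a vector is killed by some r ≠ 0 exactly when p divides all its coordinates,
  -- so the vertices of B(ℤ/p²) are the unimodular vectors up to units.
  Unimodular : V → Set
  Unimodular (x₁ , x₂ , x₃) = ¬ (p∣ x₁ × p∣ x₂ × p∣ x₃)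

  p∤1 : Unit 1ℤ
  p∤1 p∣1 = ℕ.<-irrefl (sym (ℕ.∣1⇒≡1 (∣⇒∣ᵤ p∣1))) 1<p

  p∣-resp-≈ : ∀ {a b} → a ≈ b → p∣ a → p∣ b
  p∣-resp-≈ = ∣-resp-≈ (ℕ.divides p refl)

  unit-* : ∀ {x y} → Unit x → Unit y → Unit (x * y)
  unit-* {x} {y} p∤x p∤y p∣xy
    with euclidsLemma ∣ x ∣ ∣ y ∣ p-prime (subst (p ℕ.∣_) (abs-* x y) (∣⇒∣ᵤ p∣xy))
  ... | inj₁ p∣x = p∤x (∣ᵤ⇒∣ p∣x)
  ... | inj₂ p∣y = p∤y (∣ᵤ⇒∣ p∣y)

  coprime-p² : ∀ {r} → ¬ p ℕ.∣ r → Coprime r n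
  coprime-p² {r} p∤r {d} (d∣r , d∣pp) with prime⇒irreducible p-prime (gcd[m,n]∣n d p)
  ... | inj₂ gcd≡p = ⊥-elim (p∤r (ℕ.∣-trans (subst (ℕ._∣ d) gcd≡p (gcd[m,n]∣m d p)) d∣r))
  ... | inj₁ gcd≡1 = d⊥p (ℕ.∣-refl , coprime-divisor d⊥p d∣pp)
    where
    d⊥p : Coprime d p
    d⊥p = gcd≡1⇒coprime gcd≡1

  unit-invertible : ∀ {x} → .(Unit x) → Σ[ y ∈ ℤ ] x * y ≈ 1ℤ
  unit-invertible {x} p∤x with coprime⇒invertible (recompute (coprime-p² p∤r))
    where
    p∤r : ¬ p ℕ.∣ x %ℕ n
    p∤r p∣r = ⊥-elim-irrelevant (p∤x (p∣-resp-≈ (%ℕ-≈ x) (∣ᵤ⇒∣ p∣r)))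
  ... | y , ry≈1 = y , ≈-trans (*-cong (≈-sym (%ℕ-≈ x)) ≈-refl) ry≈1

  -- The unit proof is irrelevant so that all inverses of x are definitionally equal, and the
  -- inverse is opaque so that conversion checking never unfolds the Bézout computation.
  opaque
    inverse : ∀ {x} → .(Unit x) → ℤ
    inverse p∤x = proj₁ (unit-invertible p∤x)

    inverseʳ : ∀ {x} .(p∤x : Unit x) → x * inverse p∤x ≈ 1ℤ
    inverseʳ p∤x = proj₂ (unit-invertible p∤x)

  inverse-unit : ∀ {x y} → x * y ≈ 1ℤ → Unit y
  inverse-unit {x} xy≈1 p∣y = p∤1 (p∣-resp-≈ xy≈1 (∣n⇒∣m*n x p∣y))

  residue : ℤ → Fin n
  residue i = fromℕ< (n%ℕd<d i n)

  residue-≈ : ∀ i → + toℕ (residue i) ≈ i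
  residue-≈ i = subst (λ r → + r ≈ i) (sym (toℕ-fromℕ< (n%ℕd<d i n))) (%ℕ-≈ i)

  quotient-by-p : ℤ → Fin p
  quotient-by-p i = fromℕ< (m<n*o⇒m/o<n (n%ℕd<d i n))

  quotient-by-p-≈ : ∀ {i} → p∣ i → + (p ℕ.* toℕ (quotient-by-p i)) ≈ i
  quotient-by-p-≈ {i} p∣i = subst (λ r → + r ≈ i) (sym p*[r/p]≡r) (%ℕ-≈ i)
    where
    p*[r/p]≡r : p ℕ.* toℕ (quotient-by-p i) ≡ i %ℕ n
    p*[r/p]≡r = trans (cong (p ℕ.*_) (toℕ-fromℕ< _))
                      (m*[n/m]≡n (∣⇒∣ᵤ (p∣-resp-≈ (≈-sym (%ℕ-≈ i)) p∣i)))

  p∣p* : ∀ c → p∣ + (p ℕ.* c)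
  p∣p* c = divides (+ c) (trans (pos-* p c) (*-comm (+ p) (+ c)))

  swap-unimodular : ∀ s {v} → Unimodular v → Unimodular (swap s v)
  swap-unimodular keep   prim = prim
  swap-unimodular swap₁₂ {_ , _ , _} prim (p∣₁ , p∣₂ , p∣₃) = prim (p∣₂ , p∣₁ , p∣₃)
  swap-unimodular swap₁₃ {_ , _ , _} prim (p∣₁ , p∣₂ , p∣₃) = prim (p∣₃ , p∣₂ , p∣₁)

  -- A vertex is represented by its normal form: every unimodular vector is a unit multiple
  -- of exactly one vec P (normalise, vec-unique).
  Point : Set
  Point = (Fin n × Fin n) ⊎ (Fin p × Fin n) ⊎ (Fin p × Fin p)

  vec : Point → V
  vec (inj₁ (a , b))        = 1ℤ , + toℕ a , + toℕ b
  vec (inj₂ (inj₁ (c , b))) = + (p ℕ.* toℕ c) , 1ℤ , + toℕ b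
  vec (inj₂ (inj₂ (c , d))) = + (p ℕ.* toℕ c) , + (p ℕ.* toℕ d) , 1ℤ

  vec-unimodular : ∀ P → Unimodular (vec P)
  vec-unimodular (inj₁ _)        (p∣1 , _ , _) = p∤1 p∣1
  vec-unimodular (inj₂ (inj₁ _)) (_ , p∣1 , _) = p∤1 p∣1
  vec-unimodular (inj₂ (inj₂ _)) (_ , _ , p∣1) = p∤1 p∣1

  private
    scaled-by-one : ∀ {k x y} → 1ℤ ≈ k * 1ℤ → y ≈ k * x → y ≈ x
    scaled-by-one {k} {x} 1≈k y≈kx =
      ≈-trans y≈kx (≈-trans (*-cong k≈1 (≈-refl {x})) (≡⇒≈ (*-identityˡ x)))
      where
      k≈1 : k ≈ 1ℤ
      k≈1 = ≈-sym (≈-trans 1≈k (≡⇒≈ (*-identityʳ k)))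

    one≉multiple : ∀ {k x} → p∣ x → ¬ (1ℤ ≈ k * x)
    one≉multiple {k} p∣x 1≈kx = p∤1 (p∣-resp-≈ (≈-sym 1≈kx) (∣n⇒∣m*n k p∣x))

    multiple≉unit : ∀ {k x} → Unit k → p∣ x → ¬ (x ≈ k * 1ℤ)
    multiple≉unit {k} p∤k p∣x x≈k = p∤k (p∣-resp-≈ (≈-trans x≈k (≡⇒≈ (*-identityʳ k))) p∣x)

    residue-injective : ∀ {a b : Fin n} → + toℕ a ≈ + toℕ b → a ≡ b
    residue-injective {a} {b} a≈b = toℕ-injective (+-≈-injective (toℕ<n a) (toℕ<n b) a≈b)

    multiple-injective : ∀ {c d : Fin p} → + (p ℕ.* toℕ c) ≈ + (p ℕ.* toℕ d) → c ≡ d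
    multiple-injective {c} {d} pc≈pd =
      toℕ-injective (ℕ.*-cancelˡ-≡ (toℕ c) (toℕ d) p (+-≈-injective (p*<n c) (p*<n d) pc≈pd))
      where
      p*<n : ∀ c → p ℕ.* toℕ c ℕ.< n
      p*<n c = ℕ.*-monoʳ-< p (toℕ<n c)

  vec-unique : ∀ k P Q → Unit k → vec Q ≈ᵛ k · vec P → P ≡ Q
  vec-unique k (inj₁ (a , b)) (inj₁ (a′ , b′)) _ (1≈k , a′≈ , b′≈) =
    cong inj₁ (cong₂ _,_ (sym (residue-injective (scaled-by-one {k} 1≈k a′≈)))
                         (sym (residue-injective (scaled-by-one {k} 1≈k b′≈))))
  vec-unique k (inj₂ (inj₁ (c , b))) (inj₂ (inj₁ (c′ , b′))) _ (c′≈ , 1≈k , b′≈) =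
    cong (inj₂ ∘ inj₁) (cong₂ _,_ (sym (multiple-injective (scaled-by-one {k} 1≈k c′≈)))
                                  (sym (residue-injective (scaled-by-one {k} 1≈k b′≈))))
  vec-unique k (inj₂ (inj₂ (c , d))) (inj₂ (inj₂ (c′ , d′))) _ (c′≈ , d′≈ , 1≈k) =
    cong (inj₂ ∘ inj₂) (cong₂ _,_ (sym (multiple-injective (scaled-by-one {k} 1≈k c′≈)))
                                  (sym (multiple-injective (scaled-by-one {k} 1≈k d′≈))))
  vec-unique k (inj₁ _) (inj₂ (inj₁ (c′ , _))) p∤k (c′≈ , _) =
    ⊥-elim (multiple≉unit {k} p∤k (p∣p* (toℕ c′)) c′≈)
  vec-unique k (inj₁ _) (inj₂ (inj₂ (c′ , _))) p∤k (c′≈ , _) =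
    ⊥-elim (multiple≉unit {k} p∤k (p∣p* (toℕ c′)) c′≈)
  vec-unique k (inj₂ (inj₁ _)) (inj₂ (inj₂ (_ , d′))) p∤k (_ , d′≈ , _) =
    ⊥-elim (multiple≉unit {k} p∤k (p∣p* (toℕ d′)) d′≈)
  vec-unique k (inj₂ (inj₁ (c , _))) (inj₁ _) _ (1≈ , _) =
    ⊥-elim (one≉multiple {k} (p∣p* (toℕ c)) 1≈)
  vec-unique k (inj₂ (inj₂ (c , _))) (inj₁ _) _ (1≈ , _) =
    ⊥-elim (one≉multiple {k} (p∣p* (toℕ c)) 1≈)
  vec-unique k (inj₂ (inj₂ (_ , d))) (inj₂ (inj₁ _)) _ (_ , 1≈ , _) =
    ⊥-elim (one≉multiple {k} (p∣p* (toℕ d)) 1≈)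

  private
    scaled-leading : ∀ {u} (p∤u : Unit u) → 1ℤ ≈ inverse p∤u * u
    scaled-leading {u} p∤u = ≈-trans (≈-sym (inverseʳ p∤u)) (≡⇒≈ (*-comm u (inverse p∤u)))

    scaled-residue : ∀ μ x → + toℕ (residue (x * μ)) ≈ μ * x
    scaled-residue μ x = ≈-trans (residue-≈ (x * μ)) (≡⇒≈ (*-comm x μ))

    scaled-multiple : ∀ μ {x} → p∣ x → + (p ℕ.* toℕ (quotient-by-p (x * μ))) ≈ μ * x
    scaled-multiple μ {x} p∣x = ≈-trans (quotient-by-p-≈ (∣m⇒∣m*n μ p∣x)) (≡⇒≈ (*-comm x μ))

  normalise : ∀ v → Unimodular v → Σ[ P ∈ Point ] Σ[ μ ∈ ℤ ] vec P ≈ᵛ μ · v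
  normalise (x₁ , x₂ , x₃) prim with p∣? x₁ | p∣? x₂ | p∣? x₃
  ... | no p∤x₁ | _ | _ =
    inj₁ (residue (x₂ * μ) , residue (x₃ * μ)) , μ ,
    scaled-leading p∤x₁ , scaled-residue μ x₂ , scaled-residue μ x₃
    where
    μ : ℤ
    μ = inverse p∤x₁
  ... | yes p∣x₁ | no p∤x₂ | _ =
    inj₂ (inj₁ (quotient-by-p (x₁ * μ) , residue (x₃ * μ))) , μ ,
    scaled-multiple μ p∣x₁ , scaled-leading p∤x₂ , scaled-residue μ x₃
    where
    μ : ℤ
    μ = inverse p∤x₂
  ... | yes p∣x₁ | yes p∣x₂ | no p∤x₃ =
    inj₂ (inj₂ (quotient-by-p (x₁ * μ) , quotient-by-p (x₂ * μ))) , μ ,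
    scaled-multiple μ p∣x₁ , scaled-multiple μ p∣x₂ , scaled-leading p∤x₃
    where
    μ : ℤ
    μ = inverse p∤x₃
  ... | yes p∣x₁ | yes p∣x₂ | yes p∣x₃ = ⊥-elim (prim (p∣x₁ , p∣x₂ , p∣x₃))

  pivot : ∀ P → Σ[ s ∈ Swap ] Σ[ a ∈ ℤ ] Σ[ b ∈ ℤ ] swap s (vec P) ≡ (1ℤ , a , b)
  pivot (inj₁ (a , b))        = keep   , + toℕ a , + toℕ b , refl
  pivot (inj₂ (inj₁ (c , b))) = swap₁₂ , + (p ℕ.* toℕ c) , + toℕ b , refl
  pivot (inj₂ (inj₂ (c , d))) = swap₁₃ , + (p ℕ.* toℕ d) , + (p ℕ.* toℕ c) , refl

  module _ (a b : ℤ) where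

    ⊥-head : ∀ {w₁ w₂ w₃} → (1ℤ , a , b) ⊥ (w₁ , w₂ , w₃) →
             w₁ ≈ - (a * w₂ + b * w₃)
    ⊥-head {w₁} {w₂} {w₃} ⊥w = begin
      w₁                                                  ≡⟨ isolate w₁ (a * w₂) (b * w₃) ⟩
      (1ℤ * w₁ + a * w₂ + b * w₃) + - (a * w₂ + b * w₃)  ≈⟨ +-cong ⊥w ≈-refl ⟩
      0ℤ + - (a * w₂ + b * w₃)                           ≡⟨ +-identityˡ _ ⟩
      - (a * w₂ + b * w₃)                                ∎
      where
      open SetoidReasoning setoid
      isolate : ∀ x y z → x ≡ (1ℤ * x + y + z) + - (y + z)
      isolate = ℤ-Solver.solve-∀

    ⊥-tail-unimodular : ∀ {w₁ w₂ w₃} → (1ℤ , a , b) ⊥ (w₁ , w₂ , w₃) →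
                        Unimodular (w₁ , w₂ , w₃) → UnimodularPair w₂ w₃
    ⊥-tail-unimodular {w₁} ⊥w prim (p∣w₂ , p∣w₃) = prim (p∣w₁ , p∣w₂ , p∣w₃)
      where
      p∣w₁ : p∣ w₁
      p∣w₁ = p∣-resp-≈ (≈-sym (⊥-head ⊥w)) (∣m⇒∣-m (∣m∣n⇒∣m+n (∣n⇒∣m*n a p∣w₂) (∣n⇒∣m*n b p∣w₃)))

    ⊥-determined : ∀ k {w₁ w₂ w₃ w₁′ w₂′ w₃′} →
                   (1ℤ , a , b) ⊥ (w₁ , w₂ , w₃) → (1ℤ , a , b) ⊥ (w₁′ , w₂′ , w₃′) →
                   w₂′ ≈ k * w₂ → w₃′ ≈ k * w₃ → (w₁′ , w₂′ , w₃′) ≈ᵛ k · (w₁ , w₂ , w₃)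
    ⊥-determined k {w₁} {w₂} {w₃} {w₁′} {w₂′} {w₃′} ⊥w ⊥w′ w₂′≈ w₃′≈ =
      w₁′≈ , w₂′≈ , w₃′≈
      where
      open SetoidReasoning setoid
      w₁′≈ : w₁′ ≈ k * w₁
      w₁′≈ = begin
        w₁′                              ≈⟨ ⊥-head ⊥w′ ⟩
        - (a * w₂′ + b * w₃′)            ≈⟨ -‿cong (+-cong (*-cong (≈-refl {a}) w₂′≈)
                                                              (*-cong (≈-refl {b}) w₃′≈)) ⟩
        - (a * (k * w₂) + b * (k * w₃))  ≡⟨ ℤ-Solver.solve (a ∷ b ∷ k ∷ w₂ ∷ w₃ ∷ []) ⟩
        k * - (a * w₂ + b * w₃)          ≈⟨ *-cong (≈-refl {k}) (≈-sym (⊥-head ⊥w)) ⟩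
        k * w₁                           ∎

  proportional : ∀ x y x′ y′ μ μ′ → x * μ ≈ 1ℤ → x′ * μ′ ≈ 1ℤ → y * μ ≈ y′ * μ′ →
                 x′ ≈ (x′ * μ) * x × y′ ≈ (x′ * μ) * y
  proportional x y x′ y′ μ μ′ xμ≈1 x′μ′≈1 yμ≈y′μ′ = x′≈ , y′≈
    where
    open SetoidReasoning setoid
    x′≈ : x′ ≈ (x′ * μ) * x
    x′≈ = begin
      x′              ≡⟨ *-identityʳ x′ ⟨
      x′ * 1ℤ         ≈⟨ *-cong (≈-refl {x′}) (≈-sym xμ≈1) ⟩
      x′ * (x * μ)    ≡⟨ ℤ-Solver.solve (x′ ∷ x ∷ μ ∷ []) ⟩
      (x′ * μ) * x    ∎
    y′≈ : y′ ≈ (x′ * μ) * y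
    y′≈ = begin
      y′              ≡⟨ *-identityʳ y′ ⟨
      y′ * 1ℤ         ≈⟨ *-cong (≈-refl {y′}) (≈-sym x′μ′≈1) ⟩
      y′ * (x′ * μ′)  ≡⟨ ℤ-Solver.solve (y′ ∷ x′ ∷ μ′ ∷ []) ⟩
      x′ * (y′ * μ′)  ≈⟨ *-cong (≈-refl {x′}) (≈-sym yμ≈y′μ′) ⟩
      x′ * (y * μ)    ≡⟨ ℤ-Solver.solve (x′ ∷ y ∷ μ ∷ []) ⟩
      (x′ * μ) * y    ∎

  -- A point (y : z) of the projective line over ℤ/p², as z/y or as (y/z)/p.
  lineCode : ∀ y z → UnimodularPair y z → Fin n ⊎ Fin p
  lineCode y z prim with p∣? y
  ... | no p∤y  = inj₁ (residue (z * inverse p∤y))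
  ... | yes p∣y = inj₂ (quotient-by-p (y * inverse {z} (λ p∣z → prim (p∣y , p∣z))))

  lineCode-injective : ∀ {y z y′ z′} prim prim′ → lineCode y z prim ≡ lineCode y′ z′ prim′ →
                       Σ[ k ∈ ℤ ] Unit k × y′ ≈ k * y × z′ ≈ k * z
  lineCode-injective {y} {z} {y′} {z′} prim prim′ same with p∣? y | p∣? y′
  ... | no p∤y  | no p∤y′ =
    y′ * inverse p∤y , unit-* p∤y′ (inverse-unit {y} (inverseʳ p∤y)) ,
    proportional y z y′ z′ _ _ (inverseʳ p∤y) (inverseʳ p∤y′) zμ≈z′μ′
    where
    zμ≈z′μ′ : z * inverse p∤y ≈ z′ * inverse p∤y′
    zμ≈z′μ′ = ≈-trans (≈-sym (residue-≈ _))
                (subst (λ r → + toℕ r ≈ z′ * inverse p∤y′) (sym (inj₁-injective same))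
                       (residue-≈ _))
  ... | yes p∣y | yes p∣y′ =
    z′ * inverse p∤z , unit-* p∤z′ (inverse-unit {z} (inverseʳ p∤z)) ,
    ×-swap (proportional z y z′ y′ _ _ (inverseʳ p∤z) (inverseʳ p∤z′) yμ≈y′μ′)
    where
    p∤z : Unit z
    p∤z p∣z = prim (p∣y , p∣z)
    p∤z′ : Unit z′
    p∤z′ p∣z′ = prim′ (p∣y′ , p∣z′)
    yμ≈y′μ′ : y * inverse p∤z ≈ y′ * inverse p∤z′
    yμ≈y′μ′ = ≈-trans (≈-sym (quotient-by-p-≈ (∣m⇒∣m*n (inverse p∤z) p∣y)))
                (subst (λ c → + (p ℕ.* toℕ c) ≈ y′ * inverse p∤z′) (sym (inj₂-injective same))
                  (quotient-by-p-≈ (∣m⇒∣m*n (inverse p∤z′) p∣y′)))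

  unimodular-factor : ∀ e f → (e ≈ 0ℤ × f ≈ 0ℤ) ⊎
                              (Σ[ k ∈ ℤ ] Σ[ e′ ∈ ℤ ] Σ[ f′ ∈ ℤ ]
                                 e ≈ k * e′ × f ≈ k * f′ × UnimodularPair e′ f′)
  unimodular-factor e f with p∣? e ×-dec p∣? f
  ... | no prim =
    inj₂ (1ℤ , e , f , ≡⇒≈ (sym (*-identityˡ e)) , ≡⇒≈ (sym (*-identityˡ f)) , prim)
  ... | yes (divides e′ e≡e′p , divides f′ f≡f′p) with p∣? e′ ×-dec p∣? f′
  ...   | no prim′ = inj₂ (+ p , e′ , f′ , ≡⇒≈ (trans e≡e′p (*-comm e′ (+ p))) ,
                                           ≡⇒≈ (trans f≡f′p (*-comm f′ (+ p))) , prim′)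
  ...   | yes (divides e″ e′≡e″p , divides f″ f′≡f″p) =
    inj₁ (p²∣⇒≈0 e″ e≡e′p e′≡e″p , p²∣⇒≈0 f″ f≡f′p f′≡f″p)
    where
    p²∣⇒≈0 : ∀ {x x′} x″ → x ≡ x′ * + p → x′ ≡ x″ * + p → x ≈ 0ℤ
    p²∣⇒≈0 {x} {x′} x″ x≡x′p x′≡x″p = subst (_≈ 0ℤ) (sym x≡x″n) (multiple≈0 x″)
      where
      open ≡-Reasoning
      x≡x″n : x ≡ x″ * + n
      x≡x″n = begin
        x                    ≡⟨ x≡x′p ⟩
        x′ * + p             ≡⟨ cong (_* + p) x′≡x″p ⟩
        x″ * + p * + p       ≡⟨ *-assoc x″ (+ p) (+ p) ⟩
        x″ * (+ p * + p)     ≡⟨ cong (x″ *_) (pos-* p p) ⟨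
        x″ * + n             ∎

  -- The common neighbour is a cross product of (1, a, b) with w, divided by the common factor k.
  common-⊥ : ∀ a b w → Unimodular w →
             (Σ[ u ∈ V ] Unimodular u × (1ℤ , a , b) ⊥ u × w ⊥ u) ⊎
             (Σ[ k ∈ ℤ ] Unit k × w ≈ᵛ k · (1ℤ , a , b))
  common-⊥ a b (w₁ , w₂ , w₃) prim with unimodular-factor (w₂ - w₁ * a) (w₃ - w₁ * b)
  ... | inj₂ (k , f₂ , f₃ , e₂≈kf₂ , e₃≈kf₃ , prim′) =
    inj₁ ((b * f₂ - a * f₃ , f₃ , - f₂) , u-unimodular , ⊥₁ , ⊥₂)
    where
    open SetoidReasoning setoid
    u-unimodular : Unimodular (b * f₂ - a * f₃ , f₃ , - f₂)
    u-unimodular (_ , p∣f₃ , p∣-f₂) = prim′ (subst p∣_ (neg-involutive f₂) (∣m⇒∣-m p∣-f₂) , p∣f₃)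
    cancel : ∀ a b f₂ f₃ → 1ℤ * (b * f₂ - a * f₃) + a * f₃ + b * - f₂ ≡ 0ℤ
    cancel = ℤ-Solver.solve-∀
    ⊥₁ : (1ℤ , a , b) ⊥ (b * f₂ - a * f₃ , f₃ , - f₂)
    ⊥₁ = ≡⇒≈ (cancel a b f₂ f₃)
    ⊥₂ : (w₁ , w₂ , w₃) ⊥ (b * f₂ - a * f₃ , f₃ , - f₂)
    ⊥₂ = begin
      w₁ * (b * f₂ - a * f₃) + w₂ * f₃ + w₃ * - f₂
        ≡⟨ ℤ-Solver.solve (a ∷ b ∷ f₂ ∷ f₃ ∷ w₁ ∷ w₂ ∷ w₃ ∷ []) ⟩
      f₃ * (w₂ - w₁ * a) - f₂ * (w₃ - w₁ * b)       ≈⟨ +-cong (*-cong (≈-refl {f₃}) e₂≈kf₂)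
                                                             (-‿cong (*-cong (≈-refl {f₂}) e₃≈kf₃)) ⟩
      f₃ * (k * f₂) - f₂ * (k * f₃)                 ≡⟨ ℤ-Solver.solve (k ∷ f₂ ∷ f₃ ∷ []) ⟩
      0ℤ                                            ∎
  ... | inj₁ (e₂≈0 , e₃≈0) with p∣? w₁
  ...   | yes p∣w₁ = ⊥-elim (prim ( p∣w₁
                                  , p∣-resp-≈ (≈-sym (difference≈0 e₂≈0)) (∣m⇒∣m*n a p∣w₁)
                                  , p∣-resp-≈ (≈-sym (difference≈0 e₃≈0)) (∣m⇒∣m*n b p∣w₁)))
  ...   | no p∤w₁  =
    inj₂ (w₁ , p∤w₁ , ≡⇒≈ (sym (*-identityʳ w₁)) , difference≈0 e₂≈0 , difference≈0 e₃≈0)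

  points : ℕ
  points = n ℕ.* n ℕ.+ (p ℕ.* n ℕ.+ p ℕ.* p)

  points↔Point : Fin points ↔ Point
  points↔Point = ↔-trans +↔⊎ (*↔× ⊎-↔ ↔-trans +↔⊎ (*↔× ⊎-↔ *↔×))

  opaque
    point : Fin points → Point
    point = Inverse.to points↔Point

    index : Point → Fin points
    index = Inverse.from points↔Point

    point-index : ∀ P → point (index P) ≡ P
    point-index = Inverse.strictlyInverseˡ points↔Point

    point-injective : ∀ {i j} → point i ≡ point j → i ≡ j
    point-injective = Injection.injective (↔⇒↣ points↔Point)

  index-injective : ∀ {P Q} → index P ≡ index Q → P ≡ Q
  index-injective {P} {Q} eq = trans (sym (point-index P)) (trans (cong point eq) (point-index Q))

  orthogonal : Fin points → Fin points → Bool
  orthogonal i j = ⌊ vec (point i) ∙ vec (point j) ≈? 0ℤ ⌋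

  orthogonal-sym : ∀ i j → orthogonal i j ≡ orthogonal j i
  orthogonal-sym i j = cong (λ d → ⌊ d ≈? 0ℤ ⌋) (∙-comm (vec (point i)) (vec (point j)))

  brownGraph : SimpleGraph points
  brownGraph = loopless orthogonal orthogonal-sym

  adjacent⇒⊥ : ∀ {i j} → T (adj brownGraph i j) → vec (point i) ⊥ vec (point j)
  adjacent⇒⊥ ij = toWitness (loopless-adj⁻ orthogonal orthogonal-sym ij)

  ⊥⇒orthogonal : ∀ {i} P → vec (point i) ⊥ vec P → T (orthogonal i (index P))
  ⊥⇒orthogonal {i} P = fromWitness ∘ subst (λ Q → vec (point i) ⊥ vec Q) (sym (point-index P))

  degree≤ : ∀ i → degree brownGraph i ℕ.≤ n ℕ.+ p
  degree≤ i with pivot (point i)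
  ... | s , a , b , swapped = degree-≤ brownGraph i code code-injective
    where
    w : Fin points → V
    w j = swap s (vec (point j))
    ⊥w : ∀ {j} → T (adj brownGraph i j) → (1ℤ , a , b) ⊥ w j
    ⊥w {j} ij = subst (_⊥ w j) swapped
                  (subst (_≈ 0ℤ) (sym (swap-∙ s (vec (point i)) (vec (point j)))) (adjacent⇒⊥ ij))
    tail-unimodular : ∀ {j} → T (adj brownGraph i j) →
                      UnimodularPair (proj₁ (proj₂ (w j))) (proj₂ (proj₂ (w j)))
    tail-unimodular {j} ij = ⊥-tail-unimodular a b (⊥w ij) (swap-unimodular s (vec-unimodular (point j)))
    code : ∀ j → T (adj brownGraph i j) → Fin (n ℕ.+ p)
    code j ij = join n p (lineCode _ _ (tail-unimodular ij))
    code-injective : ∀ {j k} ij ik → code j ij ≡ code k ik → j ≡ k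
    code-injective {j} {k} ij ik same
      with lineCode-injective (tail-unimodular ij) (tail-unimodular ik)
                              (Injection.injective (↔⇒↣ (↔-sym +↔⊎)) same)
    ... | κ , p∤κ , w₂≈ , w₃≈ = point-injective (vec-unique κ (point j) (point k) p∤κ
                                  (unswap-≈ᵛ s κ (⊥-determined a b κ (⊥w ij) (⊥w ik) w₂≈ w₃≈)))

  diameter≤2 : ∀ i j → DistLE brownGraph i j 2
  diameter≤2 i j with pivot (point i)
  ... | s , a , b , swapped
    with common-⊥ a b (swap s (vec (point j))) (swap-unimodular s (vec-unimodular (point j)))
  ...   | inj₂ (κ , p∤κ , w≈κv) =
    subst (λ k → DistLE brownGraph i k 2) (point-injective i≡j) (0 , z≤n , nil)
    where
    i≡j : point i ≡ point j
    i≡j = vec-unique κ (point i) (point j) p∤κ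
            (unswap-≈ᵛ s κ (subst (λ v → swap s (vec (point j)) ≈ᵛ κ · v) (sym swapped) w≈κv))
  ...   | inj₁ (u , u-unimodular , ⊥u , ⊥′u) with normalise (swap s u) (swap-unimodular s u-unimodular)
  ...     | Q , μ , vecQ≈μu =
    loopless-DistLE2 orthogonal orthogonal-sym (⊥⇒orthogonal Q i⊥Q)
                     (subst T (orthogonal-sym j (index Q)) (⊥⇒orthogonal Q j⊥Q))
    where
    i⊥Q : vec (point i) ⊥ vec Q
    i⊥Q = ⊥-scaled (vec (point i)) μ vecQ≈μu (swap-⊥ s (subst (_⊥ u) (sym swapped) ⊥u))
    j⊥Q : vec (point j) ⊥ vec Q
    j⊥Q = ⊥-scaled (vec (point j)) μ vecQ≈μu (swap-⊥ s ⊥′u)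

  zeroₚ : Fin p
  zeroₚ = fromℕ< 0<p

  zeroₙ oneₙ : Fin n
  zeroₙ = fromℕ< 0<n
  oneₙ  = fromℕ< 1<n

  origin far-from-origin : Point
  origin          = inj₁ (zeroₙ , zeroₙ)
  far-from-origin = inj₁ (zeroₙ , oneₙ)

  -- The p² + p neighbours (0, 1, b) and (0, pd, 1) of (1, 0, 0).
  axis : Fin n ⊎ Fin p → Point
  axis (inj₁ b) = inj₂ (inj₁ (zeroₚ , b))
  axis (inj₂ d) = inj₂ (inj₂ (zeroₚ , d))

  axis-injective : Injective _≡_ _≡_ axis
  axis-injective {inj₁ _} {inj₁ _} refl = refl
  axis-injective {inj₂ _} {inj₂ _} refl = refl

  origin-⊥ : ∀ {w₁ w₂ w₃} → w₁ ≡ 0ℤ → vec origin ⊥ (w₁ , w₂ , w₃)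
  origin-⊥ refl rewrite toℕ-fromℕ< 0<n = ≈-refl

  p*zeroₚ≡0 : + (p ℕ.* toℕ zeroₚ) ≡ 0ℤ
  p*zeroₚ≡0 = cong +_ (trans (cong (p ℕ.*_) (toℕ-fromℕ< 0<p)) (ℕ.*-zeroʳ p))

  origin-⊥-axis : ∀ x → vec origin ⊥ vec (axis x)
  origin-⊥-axis (inj₁ _) = origin-⊥ p*zeroₚ≡0
  origin-⊥-axis (inj₂ _) = origin-⊥ p*zeroₚ≡0

  origin-neighbour : Fin (n ℕ.+ p) → Fin points
  origin-neighbour = index ∘ axis ∘ splitAt n

  origin-neighbour-adjacent : ∀ k → T (adj brownGraph (index origin) (origin-neighbour k))
  origin-neighbour-adjacent k =
    loopless-adj orthogonal orthogonal-sym distinct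
      (⊥⇒orthogonal (axis x) (subst (_⊥ vec (axis x)) (cong vec (sym (point-index origin))) (origin-⊥-axis x)))
    where
    x : Fin n ⊎ Fin p
    x = splitAt n k
    distinct : index origin ≢ origin-neighbour k
    distinct eq with splitAt n k | index-injective eq
    ... | inj₁ _ | ()
    ... | inj₂ _ | ()

  degree-origin : degree brownGraph (index origin) ≡ n ℕ.+ p
  degree-origin = ℕ.≤-antisym (degree≤ (index origin))
    (≤-degree brownGraph (index origin) origin-neighbour
      (Injection.injective (↔⇒↣ +↔⊎) ∘ axis-injective ∘ index-injective) origin-neighbour-adjacent)

  maxDegree : MaxDegree brownGraph (n ℕ.+ p)
  maxDegree = degree≤ , index origin , degree-origin

  origin-not-⊥ : ¬ (vec origin ⊥ vec far-from-origin)
  origin-not-⊥ rewrite toℕ-fromℕ< 0<n = 1≉0 1<n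

  diameter : Diameter brownGraph 2
  diameter = diameter≤2 , index origin , index far-from-origin ,
             ¬adj⇒¬DistLE1 brownGraph distinct non-adjacent
    where
    distinct : index origin ≢ index far-from-origin
    distinct eq = ℕ.0≢1+n (trans (sym (toℕ-fromℕ< 0<n)) (trans (cong toℕ zeroₙ≡oneₙ) (toℕ-fromℕ< 1<n)))
      where
      zeroₙ≡oneₙ : zeroₙ ≡ oneₙ
      zeroₙ≡oneₙ = cong proj₂ (inj₁-injective (index-injective eq))
    non-adjacent : ¬ T (adj brownGraph (index origin) (index far-from-origin))
    non-adjacent = origin-not-⊥
                 ∘ subst₂ (λ P Q → vec P ⊥ vec Q) (point-index origin) (point-index far-from-origin)
                 ∘ adjacent⇒⊥

17-prime : Prime 17
17-prime = from-yes (prime? 17)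

open BrownGraph 17 17-prime
  using ( brownGraph; maxDegree; diameter; diameter≤2; index; origin; degree-origin
        ; origin-neighbour; origin-neighbour-adjacent )

mainTheorem4 : Σ (SimpleGraph 88723) (λ G → MaxDegree G 306 × Diameter G 2)
               × Σ (SimpleGraph 88724) (λ G → MaxDegree G 307 × Diameter G 2)
mainTheorem4 =
  (brownGraph , maxDegree , diameter) ,
  (twin brownGraph u , twin-maxDegree brownGraph u maxDegree u∼origin degree-origin ,
                       twin-diameter brownGraph u diameter≤2 u∼origin)
  where
  u : Fin 88723
  u = origin-neighbour zero
  u∼origin : T (adj brownGraph u (index origin))
  u∼origin = adj-sym brownGraph (origin-neighbour-adjacent zero)
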